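{- For all integers $r \ge 1$ and $n \ge 1$, \[ U_{2r-1}(2n-1) = (-1)^r\binom{2n}{n}\sum_{0 \le j \le k \le r} \frac{(1-n)_k\, (n-1-r)_{r-k}}{(r-k)!\,(k-j)!\,(k+2)_j}\,\left(j+\tfrac12\right)^{2r-1}. \]
   Context: For $r\in\mathbb{N}$ and $n\in\mathbb{Z}$ define \[ U_r(n) = \sum_{k\in\mathbb{Z}} \binom{n}{k}\left|\frac{n}{2}-k\right|^r, \] where $0^0=1$, and for $n\ge0$ the binomial coefficient $\binom{n}{k}$ is $0$ if $k<0$ or $k>n$ and $\frac{n!}{(n-k)!\,k!}$ otherwise. $(x)_k = x(x+1)\cdots(x+k-1)$ is the rising factorial, with $(x)_0=1$. -}

module Defs where

open import Data.Nat as ℕ using (ℕ; zero; suc)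
open import Data.Nat.Combinatorics using (_C_)
open import Data.Integer as ℤ using (ℤ; +_)
open import Data.Rational as ℚ using (ℚ; _/_; 0ℚ; 1ℚ; ∣_∣)

_^Q_ : ℚ → ℕ → ℚ
p ^Q zero = 1ℚ
p ^Q suc k = p ℚ.* (p ^Q k)

-- ΣQ m f = f 0 + f 1 + ... + f m  (inclusive upper bound)
ΣQ : ℕ → (ℕ → ℚ) → ℚ
ΣQ zero f = f 0
ΣQ (suc m) f = ΣQ m f ℚ.+ f (suc m)

rising : ℤ → ℕ → ℤ
rising x zero = ℤ.1ℤ
rising x (suc k) = rising x k ℤ.* (x ℤ.+ + k)

risingℕ : ℕ → ℕ → ℕ
risingℕ x zero = 1
risingℕ x (suc k) = risingℕ x k ℕ.* (x ℕ.+ k)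

-- reciprocal of a natural number as a rational; only ever applied to
-- nonzero arguments in the statement (the zero case is a dummy)
invℕ : ℕ → ℚ
invℕ zero = 0ℚ
invℕ (suc m) = + 1 / suc m

-- U_r(n) = Σ_k C(n,k) |n/2 - k|^r  for n ≥ 0; terms with k < 0 or k > n vanish
U : ℕ → ℕ → ℚ
U r n = ΣQ n (λ k → ((+ (n C k)) / 1) ℚ.* (∣ ((+ n) / 2) ℚ.- ((+ k) / 1) ∣ ^Q r))

rhsTerm : ℕ → ℕ → ℕ → ℕ → ℚ
rhsTerm n r k j =
  ((rising (ℤ.1ℤ ℤ.- + n) k ℤ.* rising (+ n ℤ.- ℤ.1ℤ ℤ.- + r) (r ℕ.∸ k)) / 1)
  ℚ.* invℕ (((r ℕ.∸ k) ℕ.!) ℕ.* ((k ℕ.∸ j) ℕ.!) ℕ.* risingℕ (k ℕ.+ 2) j)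
  ℚ.* (((+ (2 ℕ.* j ℕ.+ 1)) / 2) ^Q (2 ℕ.* r ℕ.∸ 1))

RHS : ℕ → ℕ → ℚ
RHS r n = ((ℚ.- 1ℚ) ^Q r) ℚ.* ((+ ((2 ℕ.* n) C n)) / 1)
          ℚ.* ΣQ r (λ k → ΣQ k (λ j → rhsTerm n r k j))

-- Put n = m + 1 and s = 2r - 1. Folding the binomial sum U_s(2m+1) about its centre gives
-- U_s(2m+1) = 2 W_s(m), where W_s(m) = Σ_{j ≤ m} C(2m+1, m-j) (j+½)^s is foldedSum. The ratio
-- Q_s(m) = W_s(m) / C(2m+1, m), foldedRatio, equals (m+1)/2 for s = 1, and the identity
-- (j+½)² = (m+½)² - (m-j)(m+j+1) together with absorption of binomial coefficients gives
-- Q_{s+2}(m) = Q_s(m)/4 + m(m+1)(Q_s(m) - Q_s(m-1)). Hence Q_{2r-1} is a polynomial in m of degree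
-- at most r, and the right-hand side is its Lagrange interpolation at the nodes 0, …, r: since
-- (k-j)! (k+2)_j C(2k+1, k-j) = k! C(2k+1, k), the inner sum over j is a multiple of Q_{2r-1}(k),
-- the outer coefficient is (-1)^r times the k-th Lagrange basis polynomial at m, and
-- C(2n, n) = 2 C(2m+1, m).

module Submission where

open import Defs
open import Level using (0ℓ)
open import Data.Empty using (⊥-elim)
open import Data.Sum using ([_,_]′)
open import Function.Base using (_∘_)
open import Data.Nat as ℕ using (ℕ; zero; suc; z≤n; s≤s; _!)
import Data.Nat.Properties as ℕP
open import Data.Nat.Combinatorics using (_C_; nCk≡n!/k![n-k]!; k![n∸k]!∣n!; nCk≡nC[n∸k]; nCk+nC[k+1]≡[n+1]C[k+1])
open import Data.Nat.DivMod using (m/n*n≡m)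
open import Data.Integer as ℤ using (ℤ; +_)
import Data.Integer.Properties as ℤP
open import Data.Rational as ℚ using (ℚ; _/_; _+_; _*_; _-_; -_; 0ℚ; 1ℚ; ½; ∣_∣)
import Data.Rational.Properties as ℚP
import Data.Rational.Unnormalised as ℚᵘ
import Data.Rational.Unnormalised.Properties as ℚᵘP
open import Relation.Binary.PropositionalEquality
open import Relation.Binary.Definitions using (tri<; tri≈; tri>)
open import Relation.Nullary using (yes; no)
open import Relation.Nullary.Decidable.Core using (dec⇒maybe)
open import Tactic.RingSolver.Core.AlmostCommutativeRing using (AlmostCommutativeRing; fromCommutativeRing)
open import Tactic.RingSolver using (solve-∀)
import Data.Nat.Tactic.RingSolver as ℕ-Ring

ℚ-ring : AlmostCommutativeRing 0ℓ 0ℓ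
ℚ-ring = fromCommutativeRing ℚP.+-*-commutativeRing (λ p → dec⇒maybe (0ℚ ℚ.≟ p))

-- ℚ normalises every result, so homomorphism laws are transported from the unnormalised ℚᵘ.
fromℚᵘ-homo-+ : ∀ p q → ℚ.fromℚᵘ (p ℚᵘ.+ q) ≡ ℚ.fromℚᵘ p + ℚ.fromℚᵘ q
fromℚᵘ-homo-+ p q = ℚP.toℚᵘ-injective (ℚᵘP.≃-trans (ℚP.toℚᵘ-fromℚᵘ (p ℚᵘ.+ q))
  (ℚᵘP.≃-sym (ℚᵘP.≃-trans (ℚP.toℚᵘ-homo-+ (ℚ.fromℚᵘ p) (ℚ.fromℚᵘ q))
                          (ℚᵘP.+-cong (ℚP.toℚᵘ-fromℚᵘ p) (ℚP.toℚᵘ-fromℚᵘ q)))))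

fromℚᵘ-homo-* : ∀ p q → ℚ.fromℚᵘ (p ℚᵘ.* q) ≡ ℚ.fromℚᵘ p * ℚ.fromℚᵘ q
fromℚᵘ-homo-* p q = ℚP.toℚᵘ-injective (ℚᵘP.≃-trans (ℚP.toℚᵘ-fromℚᵘ (p ℚᵘ.* q))
  (ℚᵘP.≃-sym (ℚᵘP.≃-trans (ℚP.toℚᵘ-homo-* (ℚ.fromℚᵘ p) (ℚ.fromℚᵘ q))
                          (ℚᵘP.*-cong (ℚP.toℚᵘ-fromℚᵘ p) (ℚP.toℚᵘ-fromℚᵘ q)))))

fromℚᵘ-homo-neg : ∀ p → ℚ.fromℚᵘ (ℚᵘ.- p) ≡ - ℚ.fromℚᵘ p
fromℚᵘ-homo-neg p = ℚP.toℚᵘ-injective (ℚᵘP.≃-trans (ℚP.toℚᵘ-fromℚᵘ (ℚᵘ.- p))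
  (ℚᵘP.≃-sym (ℚᵘP.≃-trans (ℚP.toℚᵘ-homo‿- (ℚ.fromℚᵘ p)) (ℚᵘP.-‿cong (ℚP.toℚᵘ-fromℚᵘ p)))))

fromℤ : ℤ → ℚ
fromℤ i = i / 1

fromℕ : ℕ → ℚ
fromℕ n = fromℤ (+ n)

fromℤ-homo-+ : ∀ i j → fromℤ (i ℤ.+ j) ≡ fromℤ i + fromℤ j
fromℤ-homo-+ i j = trans (ℚP.fromℚᵘ-cong {ℚᵘ.mkℚᵘ (i ℤ.+ j) 0} {i/1 ℚᵘ.+ j/1} (ℚᵘ.*≡* eq))
                         (fromℚᵘ-homo-+ i/1 j/1)
  where
  i/1 = ℚᵘ.mkℚᵘ i 0
  j/1 = ℚᵘ.mkℚᵘ j 0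
  eq : (i ℤ.+ j) ℤ.* + 1 ≡ (i ℤ.* + 1 ℤ.+ j ℤ.* + 1) ℤ.* + 1
  eq = cong (ℤ._* + 1) (sym (cong₂ ℤ._+_ (ℤP.*-identityʳ i) (ℤP.*-identityʳ j)))

fromℤ-homo-* : ∀ i j → fromℤ (i ℤ.* j) ≡ fromℤ i * fromℤ j
fromℤ-homo-* i j = fromℚᵘ-homo-* (ℚᵘ.mkℚᵘ i 0) (ℚᵘ.mkℚᵘ j 0)

fromℤ-homo-- : ∀ i j → fromℤ (i ℤ.- j) ≡ fromℤ i - fromℤ j
fromℤ-homo-- i j = trans (fromℤ-homo-+ i (ℤ.- j)) (cong (λ q → fromℤ i + q) (fromℚᵘ-homo-neg (ℚᵘ.mkℚᵘ j 0)))

fromℕ-homo-+ : ∀ a b → fromℕ (a ℕ.+ b) ≡ fromℕ a + fromℕ b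
fromℕ-homo-+ a b = fromℤ-homo-+ (+ a) (+ b)

fromℕ-homo-* : ∀ a b → fromℕ (a ℕ.* b) ≡ fromℕ a * fromℕ b
fromℕ-homo-* a b = trans (cong fromℤ (ℤP.pos-* a b)) (fromℤ-homo-* (+ a) (+ b))

fromℕ-suc : ∀ a → fromℕ (suc a) ≡ fromℕ a + 1ℚ
fromℕ-suc a = trans (cong fromℕ (ℕP.+-comm 1 a)) (fromℕ-homo-+ a 1)

n/2≡n*½ : ∀ n → + n / 2 ≡ fromℕ n * ½
n/2≡n*½ n = trans (ℚP.fromℚᵘ-cong {ℚᵘ.mkℚᵘ (+ n) 1} {ℚᵘ.mkℚᵘ (+ n) 0 ℚᵘ.* ℚᵘ.mkℚᵘ (+ 1) 1}
                                   (ℚᵘ.*≡* (cong (ℤ._* + 2) (sym (ℤP.*-identityʳ (+ n))))))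
                  (fromℚᵘ-homo-* (ℚᵘ.mkℚᵘ (+ n) 0) (ℚᵘ.mkℚᵘ (+ 1) 1))

invℕ-homo-* : ∀ a b → a ≢ 0 → b ≢ 0 → invℕ (a ℕ.* b) ≡ invℕ a * invℕ b
invℕ-homo-* zero b a≢0 _ = ⊥-elim (a≢0 refl)
invℕ-homo-* (suc a) zero _ b≢0 = ⊥-elim (b≢0 refl)
invℕ-homo-* (suc a) (suc b) _ _ = fromℚᵘ-homo-* (ℚᵘ.mkℚᵘ (+ 1) a) (ℚᵘ.mkℚᵘ (+ 1) b)

invℕ-inverseʳ : ∀ n → n ≢ 0 → fromℕ n * invℕ n ≡ 1ℚ
invℕ-inverseʳ zero n≢0 = ⊥-elim (n≢0 refl)
invℕ-inverseʳ (suc n) _ = sym (trans (ℚP.fromℚᵘ-cong {ℚᵘ.mkℚᵘ (+ 1) 0} {n/1 ℚᵘ.* 1/n} (ℚᵘ.*≡* eq))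
                                     (fromℚᵘ-homo-* n/1 1/n))
  where
  n/1 = ℚᵘ.mkℚᵘ (+ suc n) 0
  1/n = ℚᵘ.mkℚᵘ (+ 1) n
  eq : + 1 ℤ.* + suc (n ℕ.+ 0) ≡ + suc n ℤ.* + 1 ℤ.* + 1
  eq = trans (ℤP.*-identityˡ _) (trans (cong (λ k → + suc k) (ℕP.+-identityʳ n))
         (sym (trans (ℤP.*-identityʳ _) (ℤP.*-identityʳ _))))

fromℕ-homo-*³ : ∀ a b c → fromℕ (a ℕ.* b ℕ.* c) ≡ fromℕ a * fromℕ b * fromℕ c
fromℕ-homo-*³ a b c = trans (fromℕ-homo-* (a ℕ.* b) c) (cong (_* fromℕ c) (fromℕ-homo-* a b))

fromℕ-homo-∸ : ∀ {m n} → n ℕ.≤ m → fromℕ (m ℕ.∸ n) ≡ fromℕ m - fromℕ n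
fromℕ-homo-∸ {m} {n} n≤m = begin
  fromℕ (m ℕ.∸ n)                     ≡⟨ add-sub (fromℕ (m ℕ.∸ n)) (fromℕ n) ⟩
  fromℕ (m ℕ.∸ n) + fromℕ n - fromℕ n ≡⟨ cong (_- fromℕ n) (fromℕ-homo-+ (m ℕ.∸ n) n) ⟨
  fromℕ (m ℕ.∸ n ℕ.+ n) - fromℕ n     ≡⟨ cong (λ k → fromℕ k - fromℕ n) (ℕP.m∸n+n≡m n≤m) ⟩
  fromℕ m - fromℕ n                   ∎
  where
  open ≡-Reasoning
  add-sub : ∀ x y → x ≡ x + y - y
  add-sub = solve-∀ ℚ-ring

fromℕ-2m+1 : ∀ m → fromℕ (suc (m ℕ.+ m)) ≡ fromℕ m + fromℕ m + 1ℚ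
fromℕ-2m+1 m = trans (fromℕ-suc (m ℕ.+ m)) (cong (_+ 1ℚ) (fromℕ-homo-+ m m))

!≢0 : ∀ n → n ! ≢ 0
!≢0 n = ℕ.≢-nonZero⁻¹ (n !) {{n ℕP.!≢0}}

*-fromℕ-invℕ : ∀ x n → n ≢ 0 → x * fromℕ n * invℕ n ≡ x
*-fromℕ-invℕ x n n≢0 = trans (ℚP.*-assoc x (fromℕ n) (invℕ n))
  (trans (cong (x *_) (invℕ-inverseʳ n n≢0)) (ℚP.*-identityʳ x))

*-invℕ-fromℕ : ∀ x n → n ≢ 0 → x * invℕ n * fromℕ n ≡ x
*-invℕ-fromℕ x n n≢0 = trans (ℚP.*-assoc x (invℕ n) (fromℕ n))
  (trans (cong (x *_) (trans (ℚP.*-comm (invℕ n) (fromℕ n)) (invℕ-inverseʳ n n≢0))) (ℚP.*-identityʳ x))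

invℕ-unique : ∀ a b c → a ℕ.* b ≡ c → c ≢ 0 → invℕ a ≡ fromℕ b * invℕ c
invℕ-unique a b c ab≡c c≢0 = begin
  invℕ a                                     ≡⟨ *-fromℕ-invℕ (invℕ a) c c≢0 ⟨
  invℕ a * fromℕ c * invℕ c                  ≡⟨ cong (λ x → invℕ a * fromℕ x * invℕ c) ab≡c ⟨
  invℕ a * fromℕ (a ℕ.* b) * invℕ c          ≡⟨ cong (λ x → invℕ a * x * invℕ c) (fromℕ-homo-* a b) ⟩
  invℕ a * (fromℕ a * fromℕ b) * invℕ c      ≡⟨ regroup (invℕ a) (fromℕ a) (fromℕ b) (invℕ c) ⟩
  fromℕ a * invℕ a * (fromℕ b * invℕ c)      ≡⟨ cong (_* (fromℕ b * invℕ c)) (invℕ-inverseʳ a a≢0) ⟩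
  1ℚ * (fromℕ b * invℕ c)                    ≡⟨ ℚP.*-identityˡ (fromℕ b * invℕ c) ⟩
  fromℕ b * invℕ c                           ∎
  where
  open ≡-Reasoning
  a≢0 : a ≢ 0
  a≢0 refl = c≢0 (sym ab≡c)
  regroup : ∀ i a b j → i * (a * b) * j ≡ a * i * (b * j)
  regroup = solve-∀ ℚ-ring

^Q-+ : ∀ p a b → p ^Q (a ℕ.+ b) ≡ p ^Q a * p ^Q b
^Q-+ p zero b = sym (ℚP.*-identityˡ (p ^Q b))
^Q-+ p (suc a) b = trans (cong (p *_) (^Q-+ p a b)) (sym (ℚP.*-assoc p (p ^Q a) (p ^Q b)))

-1^Q-square : ∀ a → (- 1ℚ) ^Q a * (- 1ℚ) ^Q a ≡ 1ℚ
-1^Q-square zero = refl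
-1^Q-square (suc a) = trans (sign-cancel ((- 1ℚ) ^Q a)) (-1^Q-square a)
  where
  sign-cancel : ∀ s → (- 1ℚ * s) * (- 1ℚ * s) ≡ s * s
  sign-cancel = solve-∀ ℚ-ring

sign-absorb : ∀ r x → x ≡ (- 1ℚ) ^Q r * ((- 1ℚ) ^Q r * x)
sign-absorb r x = begin
  x                                     ≡⟨ ℚP.*-identityˡ x ⟨
  1ℚ * x                                ≡⟨ cong (_* x) (-1^Q-square r) ⟨
  (- 1ℚ) ^Q r * (- 1ℚ) ^Q r * x         ≡⟨ ℚP.*-assoc ((- 1ℚ) ^Q r) ((- 1ℚ) ^Q r) x ⟩
  (- 1ℚ) ^Q r * ((- 1ℚ) ^Q r * x)       ∎
  where open ≡-Reasoning

-- Finite sums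

ΣQ-cong : ∀ m {f g : ℕ → ℚ} → (∀ i → i ℕ.≤ m → f i ≡ g i) → ΣQ m f ≡ ΣQ m g
ΣQ-cong zero f≗g = f≗g 0 z≤n
ΣQ-cong (suc m) f≗g = cong₂ _+_ (ΣQ-cong m (λ i i≤m → f≗g i (ℕP.m≤n⇒m≤1+n i≤m))) (f≗g (suc m) ℕP.≤-refl)

ΣQ-*ˡ : ∀ m c (f : ℕ → ℚ) → ΣQ m (λ i → c * f i) ≡ c * ΣQ m f
ΣQ-*ˡ zero c f = refl
ΣQ-*ˡ (suc m) c f = trans (cong (_+ c * f (suc m)) (ΣQ-*ˡ m c f)) (sym (ℚP.*-distribˡ-+ c (ΣQ m f) (f (suc m))))

ΣQ-- : ∀ m (f g : ℕ → ℚ) → ΣQ m (λ i → f i - g i) ≡ ΣQ m f - ΣQ m g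
ΣQ-- zero f g = refl
ΣQ-- (suc m) f g = trans (cong (_+ (f (suc m) - g (suc m))) (ΣQ-- m f g)) (interchange (ΣQ m f) (ΣQ m g) (f (suc m)) (g (suc m)))
  where
  interchange : ∀ a b c d → (a - b) + (c - d) ≡ (a + c) - (b + d)
  interchange = solve-∀ ℚ-ring

ΣQ-zero : ∀ m (f : ℕ → ℚ) → (∀ i → i ℕ.≤ m → f i ≡ 0ℚ) → ΣQ m f ≡ 0ℚ
ΣQ-zero m f f≗0 = trans (ΣQ-cong m f≗0) (ΣQ-const0 m)
  where
  ΣQ-const0 : ∀ m → ΣQ m (λ _ → 0ℚ) ≡ 0ℚ
  ΣQ-const0 zero = refl
  ΣQ-const0 (suc m) = cong (_+ 0ℚ) (ΣQ-const0 m)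

ΣQ-single : ∀ m i (f : ℕ → ℚ) → i ℕ.≤ m → (∀ k → k ℕ.≤ m → k ≢ i → f k ≡ 0ℚ) → ΣQ m f ≡ f i
ΣQ-single zero .zero f z≤n _ = refl
ΣQ-single (suc m) i f i≤1+m others with i ℕ.≟ suc m
... | yes refl = trans (cong (_+ f (suc m))
                             (ΣQ-zero m f (λ k k≤m → others k (ℕP.m≤n⇒m≤1+n k≤m) (ℕP.<⇒≢ (s≤s k≤m)))))
                       (ℚP.+-identityˡ (f (suc m)))
... | no i≢1+m = trans (cong₂ _+_ (ΣQ-single m i f i≤m (λ k k≤m → others k (ℕP.m≤n⇒m≤1+n k≤m)))
                                   (others (suc m) ℕP.≤-refl (i≢1+m ∘ sym)))
                       (ℚP.+-identityʳ (f i))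
  where
  i≤m = ℕP.≤-pred (ℕP.≤∧≢⇒< i≤1+m i≢1+m)

ΣQ-head : ∀ m (f : ℕ → ℚ) → ΣQ (suc m) f ≡ f 0 + ΣQ m (λ i → f (suc i))
ΣQ-head zero f = refl
ΣQ-head (suc m) f = trans (cong (_+ f (suc (suc m))) (ΣQ-head m f)) (ℚP.+-assoc (f 0) (ΣQ m (λ i → f (suc i))) (f (suc (suc m))))

ΣQ-split : ∀ a b (f : ℕ → ℚ) → ΣQ (a ℕ.+ suc b) f ≡ ΣQ a f + ΣQ b (λ i → f (a ℕ.+ suc i))
ΣQ-split a zero f rewrite ℕP.+-suc a 0 | ℕP.+-identityʳ a = refl
ΣQ-split a (suc b) f rewrite ℕP.+-suc a (suc b) =
  trans (cong (_+ f (suc (a ℕ.+ suc b))) (ΣQ-split a b f))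
        (ℚP.+-assoc (ΣQ a f) (ΣQ b (λ i → f (a ℕ.+ suc i))) (f (suc (a ℕ.+ suc b))))

ΣQ-reverse : ∀ m (f : ℕ → ℚ) → ΣQ m f ≡ ΣQ m (λ i → f (m ℕ.∸ i))
ΣQ-reverse zero f = refl
ΣQ-reverse (suc m) f = begin
  ΣQ (suc m) f
    ≡⟨ ΣQ-head m f ⟩
  f 0 + ΣQ m (λ i → f (suc i))
    ≡⟨ cong (λ s → f 0 + s) (ΣQ-reverse m (λ i → f (suc i))) ⟩
  f 0 + ΣQ m (λ i → f (suc (m ℕ.∸ i)))
    ≡⟨ ℚP.+-comm (f 0) _ ⟩
  ΣQ m (λ i → f (suc (m ℕ.∸ i))) + f 0
    ≡⟨ cong₂ _+_ (ΣQ-cong m (λ i i≤m → cong f (sym (ℕP.+-∸-assoc 1 i≤m)))) (cong f (sym (ℕP.n∸n≡0 m))) ⟩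
  ΣQ (suc m) (λ i → f (suc m ℕ.∸ i)) ∎
  where open ≡-Reasoning

-- Finite differences and degree

Δ : (ℕ → ℚ) → ℕ → ℚ
Δ f m = f (suc m) - f m

-- Degree≤ d f: the (d+1)-st forward difference of f vanishes, i.e. f is a polynomial of degree at most d.
Degree≤ : ℕ → (ℕ → ℚ) → Set
Degree≤ zero f = ∀ m → f (suc m) ≡ f m
Degree≤ (suc d) f = Degree≤ d (Δ f)

degree≤-cong : ∀ d {f g : ℕ → ℚ} → (∀ m → f m ≡ g m) → Degree≤ d f → Degree≤ d g
degree≤-cong zero f≗g df m = trans (sym (f≗g (suc m))) (trans (df m) (f≗g m))
degree≤-cong (suc d) f≗g df = degree≤-cong d (λ m → cong₂ _-_ (f≗g (suc m)) (f≗g m)) df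

degree≤-const : ∀ d c → Degree≤ d (λ _ → c)
degree≤-const zero c m = refl
degree≤-const (suc d) c = degree≤-cong d (λ _ → sym (ℚP.+-inverseʳ c)) (degree≤-const d 0ℚ)

degree≤-+ : ∀ d {f g : ℕ → ℚ} → Degree≤ d f → Degree≤ d g → Degree≤ d (λ m → f m + g m)
degree≤-+ zero df dg m = cong₂ _+_ (df m) (dg m)
degree≤-+ (suc d) {f} {g} df dg =
  degree≤-cong d (λ m → interchange (f (suc m)) (f m) (g (suc m)) (g m)) (degree≤-+ d df dg)
  where
  interchange : ∀ a b c e → (a - b) + (c - e) ≡ (a + c) - (b + e)
  interchange = solve-∀ ℚ-ring

degree≤-- : ∀ d {f g : ℕ → ℚ} → Degree≤ d f → Degree≤ d g → Degree≤ d (λ m → f m - g m)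
degree≤-- zero df dg m = cong₂ _-_ (df m) (dg m)
degree≤-- (suc d) {f} {g} df dg =
  degree≤-cong d (λ m → interchange (f (suc m)) (f m) (g (suc m)) (g m)) (degree≤-- d df dg)
  where
  interchange : ∀ a b c e → (a - b) - (c - e) ≡ (a - c) - (b - e)
  interchange = solve-∀ ℚ-ring

degree≤-*ˡ : ∀ d c {f : ℕ → ℚ} → Degree≤ d f → Degree≤ d (λ m → c * f m)
degree≤-*ˡ zero c df m = cong (λ x → c * x) (df m)
degree≤-*ˡ (suc d) c {f} df = degree≤-cong d (λ m → distrib c (f (suc m)) (f m)) (degree≤-*ˡ d c df)
  where
  distrib : ∀ c a b → c * (a - b) ≡ c * a - c * b
  distrib = solve-∀ ℚ-ring

degree≤-shift : ∀ d {f : ℕ → ℚ} → Degree≤ d f → Degree≤ d (f ∘ suc)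
degree≤-shift zero df m = df (suc m)
degree≤-shift (suc d) df = degree≤-shift d df

Δ-degree≤0 : ∀ {f : ℕ → ℚ} → Degree≤ 0 f → ∀ m → Δ f m ≡ 0ℚ
Δ-degree≤0 {f} df m = trans (cong (_- f m) (df m)) (ℚP.+-inverseʳ (f m))

degree≤-suc : ∀ d {f : ℕ → ℚ} → Degree≤ d f → Degree≤ (suc d) f
degree≤-suc zero df = degree≤-cong 0 (λ m → sym (Δ-degree≤0 df m)) (degree≤-const 0 0ℚ)
degree≤-suc (suc d) df = degree≤-suc d df

degree≤0-const : ∀ {f : ℕ → ℚ} → Degree≤ 0 f → ∀ m → f m ≡ f 0
degree≤0-const df zero = refl
degree≤0-const df (suc m) = trans (df m) (degree≤0-const df m)

degree≤-ΣQ : ∀ d K (F : ℕ → ℕ → ℚ) → (∀ k → k ℕ.≤ K → Degree≤ d (F k)) →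
             Degree≤ d (λ m → ΣQ K (λ k → F k m))
degree≤-ΣQ d zero F dF = dF 0 z≤n
degree≤-ΣQ d (suc K) F dF =
  degree≤-+ d (degree≤-ΣQ d K F (λ k k≤K → dF k (ℕP.m≤n⇒m≤1+n k≤K))) (dF (suc K) ℕP.≤-refl)

degree≤-vanishing : ∀ d {f : ℕ → ℚ} → Degree≤ d f → (∀ i → i ℕ.≤ d → f i ≡ 0ℚ) → ∀ m → f m ≡ 0ℚ
degree≤-vanishing zero df f≗0 m = trans (degree≤0-const df m) (f≗0 0 z≤n)
degree≤-vanishing (suc d) {f} df f≗0 = go
  where
  Δf≗0 : ∀ m → Δ f m ≡ 0ℚ
  Δf≗0 = degree≤-vanishing d df (λ i i≤d → cong₂ _-_ (f≗0 (suc i) (s≤s i≤d)) (f≗0 i (ℕP.m≤n⇒m≤1+n i≤d)))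
  go : ∀ m → f m ≡ 0ℚ
  go zero = f≗0 0 z≤n
  go (suc m) = begin
    f (suc m)         ≡⟨ telescope (f (suc m)) (f m) ⟩
    Δ f m + f m       ≡⟨ cong₂ _+_ (Δf≗0 m) (go m) ⟩
    0ℚ                ∎
    where
    open ≡-Reasoning
    telescope : ∀ a b → a ≡ (a - b) + b
    telescope = solve-∀ ℚ-ring

Δ-*-linear : ∀ a b (f : ℕ → ℚ) m →
  Δ (λ m → (a * fromℕ m + b) * f m) m ≡ (a * fromℕ m + b) * Δ f m + a * f (suc m)
Δ-*-linear a b f m = trans (cong (λ n → (a * n + b) * f (suc m) - (a * fromℕ m + b) * f m) (fromℕ-suc m))
                          (product-rule a b (fromℕ m) (f (suc m)) (f m))
  where
  product-rule : ∀ a b n x y → (a * (n + 1ℚ) + b) * x - (a * n + b) * y ≡ (a * n + b) * (x - y) + a * x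
  product-rule = solve-∀ ℚ-ring

degree≤-*-linear : ∀ d a b {f : ℕ → ℚ} → Degree≤ d f → Degree≤ (suc d) (λ m → (a * fromℕ m + b) * f m)
degree≤-*-linear zero a b {f} df = degree≤-cong 0 Δ≡ (degree≤-*ˡ 0 a (degree≤-shift 0 df))
  where
  Δ≡ : ∀ m → a * f (suc m) ≡ Δ (λ m → (a * fromℕ m + b) * f m) m
  Δ≡ m = sym (trans (Δ-*-linear a b f m) (trans (cong (λ δ → (a * fromℕ m + b) * δ + a * f (suc m)) (Δ-degree≤0 df m))
                                                (drop (a * fromℕ m + b) (a * f (suc m)))))
    where
    drop : ∀ l x → l * 0ℚ + x ≡ x
    drop = solve-∀ ℚ-ring
degree≤-*-linear (suc d) a b {f} df = degree≤-cong (suc d) (λ m → sym (Δ-*-linear a b f m))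
  (degree≤-+ (suc d) {λ m → (a * fromℕ m + b) * Δ f m} {λ m → a * f (suc m)}
    (degree≤-*-linear d a b df) (degree≤-*ˡ (suc d) a (degree≤-shift (suc d) {f} df)))

Δ-*-pred : ∀ (f : ℕ → ℚ) m → Δ (λ m → fromℕ m * f (m ℕ.∸ 1)) m ≡ f m + fromℕ m * Δ f (m ℕ.∸ 1)
Δ-*-pred f zero = at-zero (f 0) (f 1)
  where
  at-zero : ∀ x y → 1ℚ * x - 0ℚ * x ≡ x + 0ℚ * (y - x)
  at-zero = solve-∀ ℚ-ring
Δ-*-pred f (suc m) = trans (cong (λ n → n * f (suc m) - fromℕ (suc m) * f m) (fromℕ-suc (suc m)))
                           (product-rule (fromℕ (suc m)) (f (suc m)) (f m))
  where
  product-rule : ∀ n x y → (n + 1ℚ) * x - n * y ≡ x + n * (x - y)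
  product-rule = solve-∀ ℚ-ring

degree≤-*-pred : ∀ d {f : ℕ → ℚ} → Degree≤ d f → Degree≤ (suc d) (λ m → fromℕ m * f (m ℕ.∸ 1))
degree≤-*-pred zero {f} df = degree≤-cong 0 Δ≡ df
  where
  Δ≡ : ∀ m → f m ≡ Δ (λ m → fromℕ m * f (m ℕ.∸ 1)) m
  Δ≡ m = sym (trans (Δ-*-pred f m) (trans (cong (λ δ → f m + fromℕ m * δ) (Δ-degree≤0 df (m ℕ.∸ 1)))
                                          (drop (f m) (fromℕ m))))
    where
    drop : ∀ x l → x + l * 0ℚ ≡ x
    drop = solve-∀ ℚ-ring
degree≤-*-pred (suc d) {f} df = degree≤-cong (suc d) (λ m → sym (Δ-*-pred f m))
  (degree≤-+ (suc d) {f} {λ m → fromℕ m * Δ f (m ℕ.∸ 1)} df (degree≤-*-pred d df))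

-- Rising factorials and Lagrange interpolation

risingℚ : ℚ → ℕ → ℚ
risingℚ x zero = 1ℚ
risingℚ x (suc k) = risingℚ x k * (x + fromℕ k)

fromℤ-rising : ∀ x k → fromℤ (rising x k) ≡ risingℚ (fromℤ x) k
fromℤ-rising x zero = refl
fromℤ-rising x (suc k) = trans (fromℤ-homo-* (rising x k) (x ℤ.+ + k)) (cong₂ _*_ (fromℤ-rising x k) (fromℤ-homo-+ x (+ k)))

risingℚ-unfoldˡ : ∀ x k → risingℚ x (suc k) ≡ x * risingℚ (x + 1ℚ) k
risingℚ-unfoldˡ x zero = unit x
  where
  unit : ∀ x → 1ℚ * (x + fromℕ 0) ≡ x * 1ℚ
  unit = solve-∀ ℚ-ring
risingℚ-unfoldˡ x (suc k) = begin
  risingℚ x (suc k) * (x + fromℕ (suc k))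
    ≡⟨ cong₂ _*_ (risingℚ-unfoldˡ x k) (cong (λ n → x + n) (fromℕ-suc k)) ⟩
  x * risingℚ (x + 1ℚ) k * (x + (fromℕ k + 1ℚ))
    ≡⟨ regroup x (risingℚ (x + 1ℚ) k) (fromℕ k) ⟩
  x * (risingℚ (x + 1ℚ) k * (x + 1ℚ + fromℕ k)) ∎
  where
  open ≡-Reasoning
  regroup : ∀ x r n → x * r * (x + (n + 1ℚ)) ≡ x * (r * (x + 1ℚ + n))
  regroup = solve-∀ ℚ-ring

risingℚ-vanishes : ∀ x t k → t ℕ.< k → x + fromℕ t ≡ 0ℚ → risingℚ x k ≡ 0ℚ
risingℚ-vanishes x t (suc k) (s≤s t≤k) x+t≡0 with t ℕ.≟ k
... | yes refl = trans (cong (risingℚ x t *_) x+t≡0) (ℚP.*-zeroʳ (risingℚ x t))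
... | no t≢k = trans (cong (_* (x + fromℕ k)) (risingℚ-vanishes x t k (ℕP.≤∧≢⇒< t≤k t≢k) x+t≡0))
                     (ℚP.*-zeroˡ (x + fromℕ k))

risingℚ-neg : ∀ a → risingℚ (- fromℕ a) a ≡ (- 1ℚ) ^Q a * fromℕ (a !)
risingℚ-neg zero = refl
risingℚ-neg (suc a) = begin
  risingℚ (- fromℕ (suc a)) (suc a)
    ≡⟨ risingℚ-unfoldˡ (- fromℕ (suc a)) a ⟩
  - fromℕ (suc a) * risingℚ (- fromℕ (suc a) + 1ℚ) a
    ≡⟨ cong (λ x → - fromℕ (suc a) * risingℚ x a) -[1+a]+1≡-a ⟩
  - fromℕ (suc a) * risingℚ (- fromℕ a) a
    ≡⟨ cong (λ x → - fromℕ (suc a) * x) (risingℚ-neg a) ⟩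
  - fromℕ (suc a) * ((- 1ℚ) ^Q a * fromℕ (a !))
    ≡⟨ regroup (fromℕ (suc a)) ((- 1ℚ) ^Q a) (fromℕ (a !)) ⟩
  (- 1ℚ) ^Q suc a * (fromℕ (suc a) * fromℕ (a !))
    ≡⟨ cong ((- 1ℚ) ^Q suc a *_) (sym (fromℕ-homo-* (suc a) (a !))) ⟩
  (- 1ℚ) ^Q suc a * fromℕ (suc a !) ∎
  where
  open ≡-Reasoning
  regroup : ∀ n s f → - n * (s * f) ≡ (- 1ℚ * s) * (n * f)
  regroup = solve-∀ ℚ-ring
  -[1+a]+1≡-a : - fromℕ (suc a) + 1ℚ ≡ - fromℕ a
  -[1+a]+1≡-a = trans (cong (λ n → - n + 1ℚ) (fromℕ-suc a)) (cancel (fromℕ a))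
    where
    cancel : ∀ n → - (n + 1ℚ) + 1ℚ ≡ - n
    cancel = solve-∀ ℚ-ring

degree≤-rising : ∀ e d a b {f : ℕ → ℚ} → Degree≤ d f →
                 Degree≤ (e ℕ.+ d) (λ m → risingℚ (a * fromℕ m + b) e * f m)
degree≤-rising zero d a b {f} df = degree≤-cong d (λ m → sym (ℚP.*-identityˡ (f m))) df
degree≤-rising (suc e) d a b {f} df =
  degree≤-cong (suc (e ℕ.+ d)) (λ m → regroup a (fromℕ m) b (fromℕ e) (risingℚ (a * fromℕ m + b) e) (f m))
               (degree≤-*-linear (e ℕ.+ d) a (b + fromℕ e) (degree≤-rising e d a b df))
  where
  regroup : ∀ a n b k r x → (a * n + (b + k)) * (r * x) ≡ (r * (a * n + b + k)) * x
  regroup = solve-∀ ℚ-ring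

-- lagrange r k is the Lagrange basis polynomial ∏_{i ≤ r, i ≠ k} (m - i) / (k - i) for the nodes 0, …, r.
lagrange : ℕ → ℕ → ℕ → ℚ
lagrange r k m = (- 1ℚ) ^Q r * (risingℚ (- fromℕ m) k * risingℚ (fromℕ m - fromℕ r) (r ℕ.∸ k))
                 * invℕ ((r ℕ.∸ k) !) * invℕ (k !)

lagrange-degree≤ : ∀ r k → k ℕ.≤ r → Degree≤ r (lagrange r k)
lagrange-degree≤ r k k≤r = subst (λ d → Degree≤ d (lagrange r k)) degree
  (degree≤-cong (k ℕ.+ ((r ℕ.∸ k) ℕ.+ 0)) pointwise
    (degree≤-*ˡ (k ℕ.+ ((r ℕ.∸ k) ℕ.+ 0)) c (degree≤-rising k ((r ℕ.∸ k) ℕ.+ 0) (- 1ℚ) 0ℚ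
      (degree≤-rising (r ℕ.∸ k) 0 1ℚ (- fromℕ r) (degree≤-const 0 1ℚ)))))
  where
  c : ℚ
  c = (- 1ℚ) ^Q r * invℕ ((r ℕ.∸ k) !) * invℕ (k !)
  degree : k ℕ.+ ((r ℕ.∸ k) ℕ.+ 0) ≡ r
  degree = trans (cong (k ℕ.+_) (ℕP.+-identityʳ (r ℕ.∸ k))) (ℕP.m+[n∸m]≡n k≤r)
  neg : ∀ x → - 1ℚ * x + 0ℚ ≡ - x
  neg = solve-∀ ℚ-ring
  sub : ∀ x y → 1ℚ * x + - y ≡ x - y
  sub = solve-∀ ℚ-ring
  regroup : ∀ s a b u v → (s * a * b) * (u * (v * 1ℚ)) ≡ s * (u * v) * a * b
  regroup = solve-∀ ℚ-ring
  pointwise : ∀ m → c * (risingℚ (- 1ℚ * fromℕ m + 0ℚ) k * (risingℚ (1ℚ * fromℕ m + - fromℕ r) (r ℕ.∸ k) * 1ℚ))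
                    ≡ lagrange r k m
  pointwise m = trans (cong₂ (λ x y → c * (risingℚ x k * (risingℚ y (r ℕ.∸ k) * 1ℚ)))
                             (neg (fromℕ m)) (sub (fromℕ m) (fromℕ r)))
                      (regroup ((- 1ℚ) ^Q r) (invℕ ((r ℕ.∸ k) !)) (invℕ (k !)) (risingℚ (- fromℕ m) k)
                               (risingℚ (fromℕ m - fromℕ r) (r ℕ.∸ k)))

lagrange-off-node : ∀ r i k → i ℕ.≤ r → k ℕ.≤ r → k ≢ i → lagrange r k i ≡ 0ℚ
lagrange-off-node r i k i≤r k≤r k≢i =
  trans (cong (λ x → (- 1ℚ) ^Q r * x * invℕ ((r ℕ.∸ k) !) * invℕ (k !)) product≡0)
        (annihilate ((- 1ℚ) ^Q r) (invℕ ((r ℕ.∸ k) !)) (invℕ (k !)))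
  where
  annihilate : ∀ s u v → s * 0ℚ * u * v ≡ 0ℚ
  annihilate = solve-∀ ℚ-ring
  cancel : ∀ i r → i - r + (r - i) ≡ 0ℚ
  cancel = solve-∀ ℚ-ring
  i-r+[r-i]≡0 : fromℕ i - fromℕ r + fromℕ (r ℕ.∸ i) ≡ 0ℚ
  i-r+[r-i]≡0 = trans (cong (λ x → fromℕ i - fromℕ r + x) (fromℕ-homo-∸ i≤r)) (cancel (fromℕ i) (fromℕ r))
  product≡0 : risingℚ (- fromℕ i) k * risingℚ (fromℕ i - fromℕ r) (r ℕ.∸ k) ≡ 0ℚ
  product≡0 with ℕP.<-cmp k i
  ... | tri≈ _ k≡i _ = ⊥-elim (k≢i k≡i)
  ... | tri> _ _ i<k = trans (cong (_* risingℚ (fromℕ i - fromℕ r) (r ℕ.∸ k))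
                                   (risingℚ-vanishes (- fromℕ i) i k i<k (ℚP.+-inverseˡ (fromℕ i))))
                             (ℚP.*-zeroˡ (risingℚ (fromℕ i - fromℕ r) (r ℕ.∸ k)))
  ... | tri< k<i _ _ = trans (cong (risingℚ (- fromℕ i) k *_)
                                   (risingℚ-vanishes (fromℕ i - fromℕ r) (r ℕ.∸ i) (r ℕ.∸ k)
                                                     (ℕP.∸-monoʳ-< k<i i≤r) i-r+[r-i]≡0))
                             (ℚP.*-zeroʳ (risingℚ (- fromℕ i) k))

lagrange-on-node : ∀ r i → i ℕ.≤ r → lagrange r i i ≡ 1ℚ
lagrange-on-node r i i≤r = begin
  s r * (risingℚ (- fromℕ i) i * risingℚ (fromℕ i - fromℕ r) j) * invℕ (j !) * invℕ (i !)
    ≡⟨ cong₂ (λ x y → x * y * invℕ (j !) * invℕ (i !)) sr (cong₂ _*_ (risingℚ-neg i) rising-j) ⟩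
  (s i * s j) * ((s i * fromℕ (i !)) * (s j * fromℕ (j !))) * invℕ (j !) * invℕ (i !)
    ≡⟨ regroup (s i) (s j) (fromℕ (i !)) (fromℕ (j !)) (invℕ (i !)) (invℕ (j !)) ⟩
  (s i * s i) * (s j * s j) * (fromℕ (i !) * invℕ (i !)) * (fromℕ (j !) * invℕ (j !))
    ≡⟨ cong₂ _*_ (cong₂ _*_ (cong₂ _*_ (-1^Q-square i) (-1^Q-square j)) (invℕ-inverseʳ (i !) (!≢0 i)))
                 (invℕ-inverseʳ (j !) (!≢0 j)) ⟩
  1ℚ ∎
  where
  open ≡-Reasoning
  s : ℕ → ℚ
  s = (- 1ℚ) ^Q_
  j = r ℕ.∸ i
  sr : s r ≡ s i * s j
  sr = trans (cong s (sym (ℕP.m+[n∸m]≡n i≤r))) (^Q-+ (- 1ℚ) i j)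
  negate : ∀ i r → i - r ≡ - (r - i)
  negate = solve-∀ ℚ-ring
  rising-j : risingℚ (fromℕ i - fromℕ r) j ≡ s j * fromℕ (j !)
  rising-j = trans (cong (λ x → risingℚ x j) (trans (negate (fromℕ i) (fromℕ r)) (cong -_ (sym (fromℕ-homo-∸ i≤r)))))
                   (risingℚ-neg j)
  regroup : ∀ a b fa fb ga gb → (a * b) * ((a * fa) * (b * fb)) * gb * ga ≡ (a * a) * (b * b) * (fa * ga) * (fb * gb)
  regroup = solve-∀ ℚ-ring

lagrange-interpolation : ∀ r (f : ℕ → ℚ) → Degree≤ r f → ∀ m → f m ≡ ΣQ r (λ k → lagrange r k m * f k)
lagrange-interpolation r f df m = trans (telescope (f m) (interpolant m))
  (trans (cong (_+ interpolant m) (degree≤-vanishing r error-degree≤ error-at-nodes m)) (ℚP.+-identityˡ (interpolant m)))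
  where
  telescope : ∀ a b → a ≡ (a - b) + b
  telescope = solve-∀ ℚ-ring
  interpolant : ℕ → ℚ
  interpolant m = ΣQ r (λ k → lagrange r k m * f k)
  error-degree≤ : Degree≤ r (λ m → f m - interpolant m)
  error-degree≤ = degree≤-- r df (degree≤-ΣQ r r (λ k m → lagrange r k m * f k)
    (λ k k≤r → degree≤-cong r (λ m → ℚP.*-comm (f k) (lagrange r k m)) (degree≤-*ˡ r (f k) (lagrange-degree≤ r k k≤r))))
  error-at-nodes : ∀ i → i ℕ.≤ r → f i - interpolant i ≡ 0ℚ
  error-at-nodes i i≤r = trans (cong (λ x → f i - x) interpolant-at-node) (ℚP.+-inverseʳ (f i))
    where
    interpolant-at-node : interpolant i ≡ f i
    interpolant-at-node = trans (ΣQ-single r i (λ k → lagrange r k i * f k) i≤r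
                                  (λ k k≤r k≢i → trans (cong (_* f k) (lagrange-off-node r i k i≤r k≤r k≢i))
                                                       (ℚP.*-zeroˡ (f k))))
                                (trans (cong (_* f i) (lagrange-on-node r i i≤r)) (ℚP.*-identityˡ (f i)))

-- Binomial identities

C*!*!≡! : ∀ a b {n} → a ℕ.+ b ≡ n → (n C a) ℕ.* (a ! ℕ.* b !) ≡ n !
C*!*!≡! a b refl = subst (λ c → ((a ℕ.+ b) C a) ℕ.* (a ! ℕ.* c !) ≡ (a ℕ.+ b) !) (ℕP.m+n∸m≡n a b)
  (trans (cong (ℕ._* (a ! ℕ.* (a ℕ.+ b ℕ.∸ a) !)) (nCk≡n!/k![n-k]! a≤a+b))
         (m/n*n≡m {{a ℕP.!* (a ℕ.+ b ℕ.∸ a) !≢0}} (k![n∸k]!∣n! a≤a+b)))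
  where
  a≤a+b = ℕP.m≤m+n a b

C-sym : ∀ a b → (a ℕ.+ b) C a ≡ (a ℕ.+ b) C b
C-sym a b = trans (nCk≡nC[n∸k] (ℕP.m≤m+n a b)) (cong ((a ℕ.+ b) C_) (ℕP.m+n∸m≡n a b))

*-cancel-!*! : ∀ a b {x y} → x ℕ.* (a ! ℕ.* b !) ≡ y ℕ.* (a ! ℕ.* b !) → x ≡ y
*-cancel-!*! a b {x} {y} = ℕP.*-cancelʳ-≡ x y (a ! ℕ.* b !) {{a ℕP.!* b !≢0}}

C-absorb : ∀ a b → suc a ℕ.* (suc (a ℕ.+ b) C suc a) ≡ suc (a ℕ.+ b) ℕ.* ((a ℕ.+ b) C a)
C-absorb a b = *-cancel-!*! a b (begin
  suc a ℕ.* c ℕ.* (a ! ℕ.* b !)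
    ≡⟨ regroup (suc a) c (a !) (b !) ⟩
  c ℕ.* (suc a ! ℕ.* b !)
    ≡⟨ C*!*!≡! (suc a) b refl ⟩
  suc (a ℕ.+ b) ℕ.* (a ℕ.+ b) !
    ≡⟨ cong (suc (a ℕ.+ b) ℕ.*_) (C*!*!≡! a b refl) ⟨
  suc (a ℕ.+ b) ℕ.* (((a ℕ.+ b) C a) ℕ.* (a ! ℕ.* b !))
    ≡⟨ ℕP.*-assoc (suc (a ℕ.+ b)) ((a ℕ.+ b) C a) (a ! ℕ.* b !) ⟨
  suc (a ℕ.+ b) ℕ.* ((a ℕ.+ b) C a) ℕ.* (a ! ℕ.* b !) ∎)
  where
  open ≡-Reasoning
  c = suc (a ℕ.+ b) C suc a
  regroup : ∀ s c f g → s ℕ.* c ℕ.* (f ℕ.* g) ≡ c ℕ.* ((s ℕ.* f) ℕ.* g)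
  regroup = ℕ-Ring.solve-∀

C-absorb² : ∀ a b → (suc (suc (a ℕ.+ b)) C suc a) ℕ.* suc a ℕ.* suc b
                    ≡ suc (suc (a ℕ.+ b)) ℕ.* suc (a ℕ.+ b) ℕ.* ((a ℕ.+ b) C a)
C-absorb² a b = *-cancel-!*! a b (begin
  c ℕ.* suc a ℕ.* suc b ℕ.* (a ! ℕ.* b !)
    ≡⟨ regroup c (suc a) (suc b) (a !) (b !) ⟩
  c ℕ.* (suc a ! ℕ.* suc b !)
    ≡⟨ C*!*!≡! (suc a) (suc b) (cong suc (ℕP.+-suc a b)) ⟩
  suc (suc (a ℕ.+ b)) ℕ.* (suc (a ℕ.+ b) ℕ.* (a ℕ.+ b) !)
    ≡⟨ cong (λ x → suc (suc (a ℕ.+ b)) ℕ.* (suc (a ℕ.+ b) ℕ.* x)) (C*!*!≡! a b refl) ⟨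
  suc (suc (a ℕ.+ b)) ℕ.* (suc (a ℕ.+ b) ℕ.* (((a ℕ.+ b) C a) ℕ.* (a ! ℕ.* b !)))
    ≡⟨ assoc (suc (suc (a ℕ.+ b))) (suc (a ℕ.+ b)) ((a ℕ.+ b) C a) (a ! ℕ.* b !) ⟩
  suc (suc (a ℕ.+ b)) ℕ.* suc (a ℕ.+ b) ℕ.* ((a ℕ.+ b) C a) ℕ.* (a ! ℕ.* b !) ∎)
  where
  open ≡-Reasoning
  c = suc (suc (a ℕ.+ b)) C suc a
  regroup : ∀ c s t f g → c ℕ.* s ℕ.* t ℕ.* (f ℕ.* g) ≡ c ℕ.* ((s ℕ.* f) ℕ.* (t ℕ.* g))
  regroup = ℕ-Ring.solve-∀
  assoc : ∀ p q c d → p ℕ.* (q ℕ.* (c ℕ.* d)) ≡ p ℕ.* q ℕ.* c ℕ.* d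
  assoc = ℕ-Ring.solve-∀

risingℕ*!≡! : ∀ x j → risingℕ (suc x) j ℕ.* x ! ≡ (x ℕ.+ j) !
risingℕ*!≡! x zero = trans (ℕP.*-identityˡ (x !)) (cong _! (sym (ℕP.+-identityʳ x)))
risingℕ*!≡! x (suc j) = begin
  risingℕ (suc x) j ℕ.* (suc x ℕ.+ j) ℕ.* x !   ≡⟨ regroup (risingℕ (suc x) j) (suc x ℕ.+ j) (x !) ⟩
  suc (x ℕ.+ j) ℕ.* (risingℕ (suc x) j ℕ.* x !) ≡⟨ cong (suc (x ℕ.+ j) ℕ.*_) (risingℕ*!≡! x j) ⟩
  suc (x ℕ.+ j) !                               ≡⟨ cong _! (ℕP.+-suc x j) ⟨
  (x ℕ.+ suc j) !                               ∎
  where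
  open ≡-Reasoning
  regroup : ∀ r s f → r ℕ.* s ℕ.* f ≡ s ℕ.* (r ℕ.* f)
  regroup = ℕ-Ring.solve-∀

central-C≢0 : ∀ m → (suc (m ℕ.+ m) C m) ≢ 0
central-C≢0 m c≡0 = !≢0 (suc (m ℕ.+ m)) (begin
  suc (m ℕ.+ m) !                               ≡⟨ C*!*!≡! m (suc m) (ℕP.+-suc m m) ⟨
  (suc (m ℕ.+ m) C m) ℕ.* (m ! ℕ.* suc m !)     ≡⟨ cong (ℕ._* (m ! ℕ.* suc m !)) c≡0 ⟩
  0                                             ∎)
  where open ≡-Reasoning

k!*central-C≢0 : ∀ k → k ! ℕ.* (suc (k ℕ.+ k) C k) ≢ 0
k!*central-C≢0 k eq = [ !≢0 k , central-C≢0 k ]′ (ℕP.m*n≡0⇒m≡0∨n≡0 (k !) eq)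

C-reflect : ∀ m i → i ℕ.≤ m → suc (m ℕ.+ m) C (m ℕ.+ suc i) ≡ suc (m ℕ.+ m) C (m ℕ.∸ i)
C-reflect m i i≤m = subst (λ n → n C (m ℕ.+ suc i) ≡ n C (m ℕ.∸ i)) total (C-sym (m ℕ.+ suc i) (m ℕ.∸ i))
  where
  total : m ℕ.+ suc i ℕ.+ (m ℕ.∸ i) ≡ suc (m ℕ.+ m)
  total = trans (regroup m i (m ℕ.∸ i)) (cong (λ k → suc (m ℕ.+ k)) (ℕP.m+[n∸m]≡n i≤m))
    where
    regroup : ∀ m i e → m ℕ.+ suc i ℕ.+ e ≡ suc (m ℕ.+ (i ℕ.+ e))
    regroup = ℕ-Ring.solve-∀

C-shrink : ∀ p j → j ℕ.≤ p →
  (suc (suc p ℕ.+ suc p) C (suc p ℕ.∸ j)) ℕ.* (suc p ℕ.∸ j) ℕ.* (suc p ℕ.+ suc j)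
  ≡ suc (suc p ℕ.+ suc p) ℕ.* (suc p ℕ.+ suc p) ℕ.* (suc (p ℕ.+ p) C (p ℕ.∸ j))
C-shrink p j j≤p = begin
  (N C (suc p ℕ.∸ j)) ℕ.* (suc p ℕ.∸ j) ℕ.* suc b
    ≡⟨ cong (λ e → (N C e) ℕ.* e ℕ.* suc b) (ℕP.+-∸-assoc 1 j≤p) ⟩
  (N C suc a) ℕ.* suc a ℕ.* suc b
    ≡⟨ subst (λ n → (suc (suc n) C suc a) ℕ.* suc a ℕ.* suc b ≡ suc (suc n) ℕ.* suc n ℕ.* (n C a))
             a+b≡ (C-absorb² a b) ⟩
  N ℕ.* (suc p ℕ.+ suc p) ℕ.* ((p ℕ.+ suc p) C a)
    ≡⟨ cong (λ n → N ℕ.* (suc p ℕ.+ suc p) ℕ.* (n C a)) (ℕP.+-suc p p) ⟩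
  N ℕ.* (suc p ℕ.+ suc p) ℕ.* (suc (p ℕ.+ p) C a) ∎
  where
  open ≡-Reasoning
  N = suc (suc p ℕ.+ suc p)
  a = p ℕ.∸ j
  b = p ℕ.+ suc j
  regroup : ∀ e p j → e ℕ.+ (p ℕ.+ suc j) ≡ p ℕ.+ suc (e ℕ.+ j)
  regroup = ℕ-Ring.solve-∀
  a+b≡ : a ℕ.+ b ≡ p ℕ.+ suc p
  a+b≡ = trans (regroup a p j) (cong (λ e → p ℕ.+ suc e) (ℕP.m∸n+n≡m j≤p))

C-central-step : ∀ p → (suc (suc p ℕ.+ suc p) C suc p) ℕ.* (suc p ℕ.* suc (suc p))
                       ≡ suc (suc p ℕ.+ suc p) ℕ.* (suc p ℕ.+ suc p) ℕ.* (suc (p ℕ.+ p) C p)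
C-central-step p = trans (sym (ℕP.*-assoc (suc (suc p ℕ.+ suc p) C suc p) (suc p) (suc (suc p))))
  (trans (C-absorb² p (suc p)) (cong (λ n → suc (suc p ℕ.+ suc p) ℕ.* (suc p ℕ.+ suc p) ℕ.* (n C p)) (ℕP.+-suc p p)))

odd-index : ∀ m → 2 ℕ.* suc m ℕ.∸ 1 ≡ suc (m ℕ.+ m)
odd-index m = trans (ℕP.+-suc m (m ℕ.+ 0)) (cong (λ x → suc (m ℕ.+ x)) (ℕP.+-identityʳ m))

central-C-double : ∀ m → (2 ℕ.* suc m) C suc m ≡ (suc (m ℕ.+ m) C m) ℕ.+ (suc (m ℕ.+ m) C m)
central-C-double m = trans (sym (nCk+nC[k+1]≡[n+1]C[k+1] (2 ℕ.* suc m ℕ.∸ 1) m))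
  (trans (cong (λ n → (n C m) ℕ.+ (n C suc m)) (odd-index m)) (cong ((suc (m ℕ.+ m) C m) ℕ.+_) (C-sym (suc m) m)))

rising-C-identity : ∀ k j → j ℕ.≤ k →
  (k ℕ.∸ j) ! ℕ.* risingℕ (k ℕ.+ 2) j ℕ.* (suc (k ℕ.+ k) C (k ℕ.∸ j)) ≡ k ! ℕ.* (suc (k ℕ.+ k) C k)
rising-C-identity k j j≤k = ℕP.*-cancelʳ-≡ _ _ (suc k !) {{suc k ℕP.!≢0}} (begin
  e ! ℕ.* risingℕ (k ℕ.+ 2) j ℕ.* (N C e) ℕ.* suc k !
    ≡⟨ cong (λ x → e ! ℕ.* risingℕ x j ℕ.* (N C e) ℕ.* suc k !) (ℕP.+-comm k 2) ⟩
  e ! ℕ.* risingℕ (suc (suc k)) j ℕ.* (N C e) ℕ.* suc k !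
    ≡⟨ regroup (e !) (risingℕ (suc (suc k)) j) (N C e) (suc k !) ⟩
  (N C e) ℕ.* (e ! ℕ.* (risingℕ (suc (suc k)) j ℕ.* suc k !))
    ≡⟨ cong (λ x → (N C e) ℕ.* (e ! ℕ.* x)) (risingℕ*!≡! (suc k) j) ⟩
  (N C e) ℕ.* (e ! ℕ.* (suc k ℕ.+ j) !)
    ≡⟨ C*!*!≡! e (suc k ℕ.+ j) e+[1+k+j]≡N ⟩
  N !
    ≡⟨ C*!*!≡! k (suc k) (ℕP.+-suc k k) ⟨
  (N C k) ℕ.* (k ! ℕ.* suc k !)
    ≡⟨ regroup′ (N C k) (k !) (suc k !) ⟩
  k ! ℕ.* (N C k) ℕ.* suc k ! ∎)
  where
  open ≡-Reasoning
  N = suc (k ℕ.+ k)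
  e = k ℕ.∸ j
  regroup : ∀ f r c g → f ℕ.* r ℕ.* c ℕ.* g ≡ c ℕ.* (f ℕ.* (r ℕ.* g))
  regroup = ℕ-Ring.solve-∀
  regroup′ : ∀ c f g → c ℕ.* (f ℕ.* g) ≡ f ℕ.* c ℕ.* g
  regroup′ = ℕ-Ring.solve-∀
  shuffle : ∀ e k j → e ℕ.+ (suc k ℕ.+ j) ≡ suc (k ℕ.+ (e ℕ.+ j))
  shuffle = ℕ-Ring.solve-∀
  e+[1+k+j]≡N : e ℕ.+ (suc k ℕ.+ j) ≡ N
  e+[1+k+j]≡N = trans (shuffle e k j) (cong (λ x → suc (k ℕ.+ x)) (ℕP.m∸n+n≡m j≤k))

-- The folded sum

odd/2 : ℕ → ℚ
odd/2 j = + (2 ℕ.* j ℕ.+ 1) / 2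

odd/2≡j+½ : ∀ j → odd/2 j ≡ fromℕ j + ½
odd/2≡j+½ j = begin
  odd/2 j
    ≡⟨ n/2≡n*½ (2 ℕ.* j ℕ.+ 1) ⟩
  fromℕ (2 ℕ.* j ℕ.+ 1) * ½
    ≡⟨ cong (_* ½) (trans (fromℕ-homo-+ (2 ℕ.* j) 1) (cong (_+ 1ℚ) (fromℕ-homo-* 2 j))) ⟩
  (fromℕ 2 * fromℕ j + 1ℚ) * ½
    ≡⟨ halve (fromℕ j) ⟩
  fromℕ j + ½ ∎
  where
  open ≡-Reasoning
  halve : ∀ x → (fromℕ 2 * x + 1ℚ) * ½ ≡ x + ½
  halve = solve-∀ ℚ-ring

∣odd/2∣ : ∀ j → ∣ odd/2 j ∣ ≡ odd/2 j
∣odd/2∣ j = ℚP.0≤p⇒∣p∣≡p (ℚP.nonNegative⁻¹ (odd/2 j) {{ℚP.normalize-nonNeg (2 ℕ.* j ℕ.+ 1) 2}})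

odd/2-square : ∀ m j → j ℕ.≤ m →
  odd/2 j * odd/2 j ≡ (fromℕ m + ½) * (fromℕ m + ½) - fromℕ (m ℕ.∸ j) * fromℕ (m ℕ.+ suc j)
odd/2-square m j j≤m = begin
  odd/2 j * odd/2 j
    ≡⟨ cong₂ _*_ (odd/2≡j+½ j) (odd/2≡j+½ j) ⟩
  (fromℕ j + ½) * (fromℕ j + ½)
    ≡⟨ identity (fromℕ m) (fromℕ j) ⟩
  (fromℕ m + ½) * (fromℕ m + ½) - (fromℕ m - fromℕ j) * (fromℕ m + (fromℕ j + 1ℚ))
    ≡⟨ cong₂ (λ x y → (fromℕ m + ½) * (fromℕ m + ½) - x * y) (fromℕ-homo-∸ j≤m)
             (trans (fromℕ-homo-+ m (suc j)) (cong (λ x → fromℕ m + x) (fromℕ-suc j))) ⟨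
  (fromℕ m + ½) * (fromℕ m + ½) - fromℕ (m ℕ.∸ j) * fromℕ (m ℕ.+ suc j) ∎
  where
  open ≡-Reasoning
  identity : ∀ m j → (j + ½) * (j + ½) ≡ (m + ½) * (m + ½) - (m - j) * (m + (j + 1ℚ))
  identity = solve-∀ ℚ-ring

foldedSum : ℕ → ℕ → ℚ
foldedSum s m = ΣQ m (λ j → fromℕ (suc (m ℕ.+ m) C (m ℕ.∸ j)) * (odd/2 j ^Q s))

foldedRatio : ℕ → ℕ → ℚ
foldedRatio s m = foldedSum s m * invℕ (suc (m ℕ.+ m) C m)

centre≡ : ∀ m → + suc (m ℕ.+ m) / 2 ≡ (fromℕ m + fromℕ m + 1ℚ) * ½
centre≡ m = trans (n/2≡n*½ (suc (m ℕ.+ m))) (cong (_* ½) (fromℕ-2m+1 m))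

∣centre-lower∣ : ∀ m i → i ℕ.≤ m → ∣ + suc (m ℕ.+ m) / 2 - fromℕ (m ℕ.∸ i) ∣ ≡ odd/2 i
∣centre-lower∣ m i i≤m = trans (cong ∣_∣ centre-lower) (∣odd/2∣ i)
  where
  distance : ∀ m i → (m + m + 1ℚ) * ½ - (m - i) ≡ i + ½
  distance = solve-∀ ℚ-ring
  centre-lower : + suc (m ℕ.+ m) / 2 - fromℕ (m ℕ.∸ i) ≡ odd/2 i
  centre-lower = trans (cong₂ _-_ (centre≡ m) (fromℕ-homo-∸ i≤m))
                       (trans (distance (fromℕ m) (fromℕ i)) (sym (odd/2≡j+½ i)))

∣centre-upper∣ : ∀ m i → ∣ + suc (m ℕ.+ m) / 2 - fromℕ (m ℕ.+ suc i) ∣ ≡ odd/2 i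
∣centre-upper∣ m i = trans (cong ∣_∣ centre-upper) (trans (ℚP.∣-p∣≡∣p∣ (odd/2 i)) (∣odd/2∣ i))
  where
  distance : ∀ m i → (m + m + 1ℚ) * ½ - (m + (i + 1ℚ)) ≡ - (i + ½)
  distance = solve-∀ ℚ-ring
  centre-upper : + suc (m ℕ.+ m) / 2 - fromℕ (m ℕ.+ suc i) ≡ - odd/2 i
  centre-upper = trans (cong₂ _-_ (centre≡ m) (trans (fromℕ-homo-+ m (suc i)) (cong (λ x → fromℕ m + x) (fromℕ-suc i))))
                       (trans (distance (fromℕ m) (fromℕ i)) (cong -_ (sym (odd/2≡j+½ i))))

U-odd : ∀ s m → U s (suc (m ℕ.+ m)) ≡ fromℕ 2 * foldedSum s m
U-odd s m = begin
  ΣQ (suc (m ℕ.+ m)) g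
    ≡⟨ cong (λ n → ΣQ n g) (ℕP.+-suc m m) ⟨
  ΣQ (m ℕ.+ suc m) g
    ≡⟨ ΣQ-split m m g ⟩
  ΣQ m g + ΣQ m (λ i → g (m ℕ.+ suc i))
    ≡⟨ cong (_+ ΣQ m (λ i → g (m ℕ.+ suc i))) (ΣQ-reverse m g) ⟩
  ΣQ m (λ i → g (m ℕ.∸ i)) + ΣQ m (λ i → g (m ℕ.+ suc i))
    ≡⟨ cong₂ _+_ (ΣQ-cong m lower) (ΣQ-cong m upper) ⟩
  foldedSum s m + foldedSum s m
    ≡⟨ double (foldedSum s m) ⟩
  fromℕ 2 * foldedSum s m ∎
  where
  open ≡-Reasoning
  N = suc (m ℕ.+ m)
  g : ℕ → ℚ
  g k = fromℕ (N C k) * (∣ + N / 2 - fromℕ k ∣ ^Q s)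
  lower : ∀ i → i ℕ.≤ m → g (m ℕ.∸ i) ≡ fromℕ (N C (m ℕ.∸ i)) * (odd/2 i ^Q s)
  lower i i≤m = cong (λ x → fromℕ (N C (m ℕ.∸ i)) * (x ^Q s)) (∣centre-lower∣ m i i≤m)
  upper : ∀ i → i ℕ.≤ m → g (m ℕ.+ suc i) ≡ fromℕ (N C (m ℕ.∸ i)) * (odd/2 i ^Q s)
  upper i i≤m = cong₂ (λ c x → fromℕ c * (x ^Q s)) (C-reflect m i i≤m) (∣centre-upper∣ m i)
  double : ∀ x → x + x ≡ fromℕ 2 * x
  double = solve-∀ ℚ-ring

foldedSum≡foldedRatio*C : ∀ s m → foldedSum s m ≡ foldedRatio s m * fromℕ (suc (m ℕ.+ m) C m)
foldedSum≡foldedRatio*C s m = sym (*-invℕ-fromℕ (foldedSum s m) (suc (m ℕ.+ m) C m) (central-C≢0 m))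

foldedSum-correction : ∀ s p →
  ΣQ (suc p) (λ j → fromℕ (suc (suc p ℕ.+ suc p) C (suc p ℕ.∸ j))
                   * (fromℕ (suc p ℕ.∸ j) * fromℕ (suc p ℕ.+ suc j)) * (odd/2 j ^Q s))
  ≡ fromℕ (suc (suc p ℕ.+ suc p)) * fromℕ (suc p ℕ.+ suc p) * foldedSum s p
foldedSum-correction s p = begin
  ΣQ p b + b (suc p)                 ≡⟨ cong₂ _+_ (ΣQ-cong p shrink) last ⟩
  ΣQ p (λ j → K * term j) + 0ℚ       ≡⟨ ℚP.+-identityʳ (ΣQ p (λ j → K * term j)) ⟩
  ΣQ p (λ j → K * term j)            ≡⟨ ΣQ-*ˡ p K term ⟩
  K * foldedSum s p                  ∎
  where
  open ≡-Reasoning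
  N = suc (suc p ℕ.+ suc p)
  K = fromℕ N * fromℕ (suc p ℕ.+ suc p)
  x b term : ℕ → ℚ
  x j = odd/2 j ^Q s
  b j = fromℕ (N C (suc p ℕ.∸ j)) * (fromℕ (suc p ℕ.∸ j) * fromℕ (suc p ℕ.+ suc j)) * x j
  term j = fromℕ (suc (p ℕ.+ p) C (p ℕ.∸ j)) * x j
  regroupˡ : ∀ c u v x → c * (u * v) * x ≡ (c * u * v) * x
  regroupˡ = solve-∀ ℚ-ring
  regroupʳ : ∀ n e c x → n * e * c * x ≡ (n * e) * (c * x)
  regroupʳ = solve-∀ ℚ-ring
  vanish : ∀ c v x → c * (0ℚ * v) * x ≡ 0ℚ
  vanish = solve-∀ ℚ-ring
  shrink : ∀ j → j ℕ.≤ p → b j ≡ K * term j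
  shrink j j≤p = begin
    b j
      ≡⟨ regroupˡ (fromℕ (N C (suc p ℕ.∸ j))) (fromℕ (suc p ℕ.∸ j)) (fromℕ (suc p ℕ.+ suc j)) (x j) ⟩
    fromℕ (N C (suc p ℕ.∸ j)) * fromℕ (suc p ℕ.∸ j) * fromℕ (suc p ℕ.+ suc j) * x j
      ≡⟨ cong (_* x j) (fromℕ-homo-*³ (N C (suc p ℕ.∸ j)) (suc p ℕ.∸ j) (suc p ℕ.+ suc j)) ⟨
    fromℕ ((N C (suc p ℕ.∸ j)) ℕ.* (suc p ℕ.∸ j) ℕ.* (suc p ℕ.+ suc j)) * x j
      ≡⟨ cong (λ n → fromℕ n * x j) (C-shrink p j j≤p) ⟩
    fromℕ (N ℕ.* (suc p ℕ.+ suc p) ℕ.* (suc (p ℕ.+ p) C (p ℕ.∸ j))) * x j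
      ≡⟨ cong (_* x j) (fromℕ-homo-*³ N (suc p ℕ.+ suc p) (suc (p ℕ.+ p) C (p ℕ.∸ j))) ⟩
    fromℕ N * fromℕ (suc p ℕ.+ suc p) * fromℕ (suc (p ℕ.+ p) C (p ℕ.∸ j)) * x j
      ≡⟨ regroupʳ (fromℕ N) (fromℕ (suc p ℕ.+ suc p)) (fromℕ (suc (p ℕ.+ p) C (p ℕ.∸ j))) (x j) ⟩
    K * term j ∎
  last : b (suc p) ≡ 0ℚ
  last = trans (cong (λ n → fromℕ (N C n) * (fromℕ n * fromℕ (suc p ℕ.+ suc (suc p))) * x (suc p)) (ℕP.n∸n≡0 p))
               (vanish (fromℕ (N C 0)) (fromℕ (suc p ℕ.+ suc (suc p))) (x (suc p)))

foldedSum-step : ∀ s p → foldedSum (suc (suc s)) (suc p)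
  ≡ (fromℕ (suc p) + ½) * (fromℕ (suc p) + ½) * foldedSum s (suc p)
    - fromℕ (suc (suc p ℕ.+ suc p)) * fromℕ (suc p ℕ.+ suc p) * foldedSum s p
foldedSum-step s p = begin
  foldedSum (suc (suc s)) (suc p)
    ≡⟨ ΣQ-cong (suc p) split ⟩
  ΣQ (suc p) (λ j → H * (c j * x j) - b j)
    ≡⟨ ΣQ-- (suc p) (λ j → H * (c j * x j)) b ⟩
  ΣQ (suc p) (λ j → H * (c j * x j)) - ΣQ (suc p) b
    ≡⟨ cong₂ _-_ (ΣQ-*ˡ (suc p) H (λ j → c j * x j)) (foldedSum-correction s p) ⟩
  H * foldedSum s (suc p) - fromℕ N * fromℕ (suc p ℕ.+ suc p) * foldedSum s p ∎
  where
  open ≡-Reasoning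
  N = suc (suc p ℕ.+ suc p)
  H = (fromℕ (suc p) + ½) * (fromℕ (suc p) + ½)
  c x b : ℕ → ℚ
  c j = fromℕ (N C (suc p ℕ.∸ j))
  x j = odd/2 j ^Q s
  b j = c j * (fromℕ (suc p ℕ.∸ j) * fromℕ (suc p ℕ.+ suc j)) * x j
  distrib : ∀ c h u v x → c * ((h - u * v) * x) ≡ h * (c * x) - c * (u * v) * x
  distrib = solve-∀ ℚ-ring
  split : ∀ j → j ℕ.≤ suc p → c j * (odd/2 j * (odd/2 j * x j)) ≡ H * (c j * x j) - b j
  split j j≤1+p = trans (cong (c j *_) (trans (sym (ℚP.*-assoc (odd/2 j) (odd/2 j) (x j)))
                                              (cong (_* x j) (odd/2-square (suc p) j j≤1+p))))
                        (distrib (c j) H (fromℕ (suc p ℕ.∸ j)) (fromℕ (suc p ℕ.+ suc j)) (x j))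

foldedRatio-step : ∀ s m → foldedRatio (suc (suc s)) m
  ≡ ½ * ½ * foldedRatio s m + (fromℕ m + 1ℚ) * (fromℕ m * Δ (foldedRatio s) (m ℕ.∸ 1))
foldedRatio-step s zero = at-zero (fromℕ (1 C 0)) (invℕ (1 C 0)) (½ ^Q s) (Δ (foldedRatio s) 0)
  where
  at-zero : ∀ c i y d → c * (½ * (½ * y)) * i ≡ ½ * ½ * (c * y * i) + (0ℚ + 1ℚ) * (0ℚ * d)
  at-zero = solve-∀ ℚ-ring
foldedRatio-step s (suc p) = begin
  foldedSum (suc (suc s)) (suc p) * invℕ C₁
    ≡⟨ cong (_* invℕ C₁) (foldedSum-step s p) ⟩
  (H * W₁ - K * W₀) * invℕ C₁
    ≡⟨ cong (λ w → (H * W₁ - K * w) * invℕ C₁) (foldedSum≡foldedRatio*C s p) ⟩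
  (H * W₁ - K * (Q₀ * fromℕ C₀)) * invℕ C₁
    ≡⟨ regroup H W₁ K Q₀ (fromℕ C₀) (invℕ C₁) ⟩
  H * Q₁ - K * fromℕ C₀ * invℕ C₁ * Q₀
    ≡⟨ cong (λ k → H * Q₁ - k * Q₀) K*C₀/C₁ ⟩
  H * Q₁ - fromℕ (suc p) * (fromℕ (suc p) + 1ℚ) * Q₀
    ≡⟨ identity (fromℕ (suc p)) Q₁ Q₀ ⟩
  ½ * ½ * Q₁ + (fromℕ (suc p) + 1ℚ) * (fromℕ (suc p) * (Q₁ - Q₀)) ∎
  where
  open ≡-Reasoning
  N = suc (suc p ℕ.+ suc p)
  C₀ = suc (p ℕ.+ p) C p
  C₁ = N C suc p
  H = (fromℕ (suc p) + ½) * (fromℕ (suc p) + ½)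
  K = fromℕ N * fromℕ (suc p ℕ.+ suc p)
  W₀ = foldedSum s p
  W₁ = foldedSum s (suc p)
  Q₀ = foldedRatio s p
  Q₁ = foldedRatio s (suc p)
  regroup : ∀ h w k q c i → (h * w - k * (q * c)) * i ≡ h * (w * i) - k * c * i * q
  regroup = solve-∀ ℚ-ring
  identity : ∀ n q₁ q₀ → (n + ½) * (n + ½) * q₁ - n * (n + 1ℚ) * q₀ ≡ ½ * ½ * q₁ + (n + 1ℚ) * (n * (q₁ - q₀))
  identity = solve-∀ ℚ-ring
  K*C₀/C₁ : K * fromℕ C₀ * invℕ C₁ ≡ fromℕ (suc p) * (fromℕ (suc p) + 1ℚ)
  K*C₀/C₁ = begin
    K * fromℕ C₀ * invℕ C₁
      ≡⟨ cong (_* invℕ C₁) (fromℕ-homo-*³ N (suc p ℕ.+ suc p) C₀) ⟨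
    fromℕ (N ℕ.* (suc p ℕ.+ suc p) ℕ.* C₀) * invℕ C₁
      ≡⟨ cong (λ n → fromℕ n * invℕ C₁) (C-central-step p) ⟨
    fromℕ (C₁ ℕ.* (suc p ℕ.* suc (suc p))) * invℕ C₁
      ≡⟨ cong (_* invℕ C₁) (trans (fromℕ-homo-* C₁ (suc p ℕ.* suc (suc p)))
                                  (ℚP.*-comm (fromℕ C₁) (fromℕ (suc p ℕ.* suc (suc p))))) ⟩
    fromℕ (suc p ℕ.* suc (suc p)) * fromℕ C₁ * invℕ C₁
      ≡⟨ *-fromℕ-invℕ (fromℕ (suc p ℕ.* suc (suc p))) C₁ (central-C≢0 (suc p)) ⟩
    fromℕ (suc p ℕ.* suc (suc p))
      ≡⟨ trans (fromℕ-homo-* (suc p) (suc (suc p))) (cong (fromℕ (suc p) *_) (fromℕ-suc (suc p))) ⟩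
    fromℕ (suc p) * (fromℕ (suc p) + 1ℚ) ∎

binomial-telescope : ∀ M a → a ℕ.≤ M →
  ΣQ a (λ k → fromℕ (suc M C k) * (fromℕ (suc M) - fromℕ 2 * fromℕ k)) ≡ fromℕ (suc M) * fromℕ (M C a)
binomial-telescope M zero _ = base (fromℕ (suc M))
  where
  base : ∀ n → 1ℚ * (n - fromℕ 2 * 0ℚ) ≡ n * 1ℚ
  base = solve-∀ ℚ-ring
binomial-telescope M (suc a) 1+a≤M = begin
  ΣQ a f + f (suc a)                          ≡⟨ cong (_+ f (suc a)) (binomial-telescope M a a≤M) ⟩
  n * P + C' * (n - fromℕ 2 * fromℕ (suc a))  ≡⟨ expand n P C' (fromℕ (suc a)) ⟩
  n * P + n * C' - fromℕ 2 * (fromℕ (suc a) * C') ≡⟨ cong (λ x → n * P + n * C' - fromℕ 2 * x) absorb ⟩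
  n * P + n * C' - fromℕ 2 * (n * P)          ≡⟨ collect n P C' ⟩
  n * (C' - P)                                ≡⟨ cong (λ x → n * (x - P)) pascal ⟩
  n * ((P + P') - P)                          ≡⟨ cancel n P P' ⟩
  n * P'                                      ∎
  where
  open ≡-Reasoning
  a≤M = ℕP.≤-trans (ℕP.n≤1+n a) 1+a≤M
  f : ℕ → ℚ
  f k = fromℕ (suc M C k) * (fromℕ (suc M) - fromℕ 2 * fromℕ k)
  n = fromℕ (suc M)
  P = fromℕ (M C a)
  P' = fromℕ (M C suc a)
  C' = fromℕ (suc M C suc a)
  expand : ∀ n p c s → n * p + c * (n - fromℕ 2 * s) ≡ n * p + n * c - fromℕ 2 * (s * c)
  expand = solve-∀ ℚ-ring
  collect : ∀ n p c → n * p + n * c - fromℕ 2 * (n * p) ≡ n * (c - p)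
  collect = solve-∀ ℚ-ring
  cancel : ∀ n p q → n * ((p + q) - p) ≡ n * q
  cancel = solve-∀ ℚ-ring
  absorbℕ : suc a ℕ.* (suc M C suc a) ≡ suc M ℕ.* (M C a)
  absorbℕ = subst (λ m → suc a ℕ.* (suc m C suc a) ≡ suc m ℕ.* (m C a)) (ℕP.m+[n∸m]≡n a≤M) (C-absorb a (M ℕ.∸ a))
  absorb : fromℕ (suc a) * C' ≡ n * P
  absorb = trans (sym (fromℕ-homo-* (suc a) (suc M C suc a))) (trans (cong fromℕ absorbℕ) (fromℕ-homo-* (suc M) (M C a)))
  pascal : C' ≡ P + P'
  pascal = trans (cong fromℕ (sym (nCk+nC[k+1]≡[n+1]C[k+1] M a))) (fromℕ-homo-+ (M C a) (M C suc a))

foldedRatio-1 : ∀ m → foldedRatio 1 m ≡ ½ * fromℕ m + ½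
foldedRatio-1 m = begin
  foldedSum 1 m * invℕ C₀
    ≡⟨ cong (_* invℕ C₀) foldedSum-1 ⟩
  ½ * (fromℕ (suc (m ℕ.+ m)) * fromℕ ((m ℕ.+ m) C m)) * invℕ C₀
    ≡⟨ cong (λ x → ½ * x * invℕ C₀) (trans (sym (fromℕ-homo-* (suc (m ℕ.+ m)) ((m ℕ.+ m) C m))) (cong fromℕ N*C≡)) ⟩
  ½ * fromℕ (suc m ℕ.* C₀) * invℕ C₀
    ≡⟨ cong (λ x → ½ * x * invℕ C₀) (fromℕ-homo-* (suc m) C₀) ⟩
  ½ * (fromℕ (suc m) * fromℕ C₀) * invℕ C₀
    ≡⟨ cong (_* invℕ C₀) (sym (ℚP.*-assoc ½ (fromℕ (suc m)) (fromℕ C₀))) ⟩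
  ½ * fromℕ (suc m) * fromℕ C₀ * invℕ C₀
    ≡⟨ *-fromℕ-invℕ (½ * fromℕ (suc m)) C₀ (central-C≢0 m) ⟩
  ½ * fromℕ (suc m)
    ≡⟨ cong (½ *_) (fromℕ-suc m) ⟩
  ½ * (fromℕ m + 1ℚ)
    ≡⟨ ℚP.*-distribˡ-+ ½ (fromℕ m) 1ℚ ⟩
  ½ * fromℕ m + ½ * 1ℚ ∎
  where
  open ≡-Reasoning
  C₀ = suc (m ℕ.+ m) C m
  N*C≡ : suc (m ℕ.+ m) ℕ.* ((m ℕ.+ m) C m) ≡ suc m ℕ.* C₀
  N*C≡ = trans (sym (C-absorb m m)) (cong (suc m ℕ.*_) (C-sym (suc m) m))
  odd/2-reversed : ∀ k → k ℕ.≤ m → odd/2 (m ℕ.∸ k) * 1ℚ ≡ ½ * (fromℕ (suc (m ℕ.+ m)) - fromℕ 2 * fromℕ k)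
  odd/2-reversed k k≤m = trans (cong (_* 1ℚ) (trans (odd/2≡j+½ (m ℕ.∸ k)) (cong (_+ ½) (fromℕ-homo-∸ k≤m))))
                               (trans (identity (fromℕ m) (fromℕ k))
                                      (cong (λ x → ½ * (x - fromℕ 2 * fromℕ k)) (sym (fromℕ-2m+1 m))))
    where
    identity : ∀ m k → (m - k + ½) * 1ℚ ≡ ½ * (m + m + 1ℚ - fromℕ 2 * k)
    identity = solve-∀ ℚ-ring
  foldedSum-1 : foldedSum 1 m ≡ ½ * (fromℕ (suc (m ℕ.+ m)) * fromℕ ((m ℕ.+ m) C m))
  foldedSum-1 = begin
    foldedSum 1 m
      ≡⟨ ΣQ-reverse m _ ⟩
    ΣQ m (λ k → fromℕ (suc (m ℕ.+ m) C (m ℕ.∸ (m ℕ.∸ k))) * (odd/2 (m ℕ.∸ k) * 1ℚ))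
      ≡⟨ ΣQ-cong m (λ k k≤m → cong₂ (λ i x → fromℕ (suc (m ℕ.+ m) C i) * x)
                                    (ℕP.m∸[m∸n]≡n k≤m) (odd/2-reversed k k≤m)) ⟩
    ΣQ m (λ k → fromℕ (suc (m ℕ.+ m) C k) * (½ * (fromℕ (suc (m ℕ.+ m)) - fromℕ 2 * fromℕ k)))
      ≡⟨ ΣQ-cong m (λ k _ → regroup (fromℕ (suc (m ℕ.+ m) C k)) ½ (fromℕ (suc (m ℕ.+ m)) - fromℕ 2 * fromℕ k)) ⟩
    ΣQ m (λ k → ½ * (fromℕ (suc (m ℕ.+ m) C k) * (fromℕ (suc (m ℕ.+ m)) - fromℕ 2 * fromℕ k)))
      ≡⟨ ΣQ-*ˡ m ½ _ ⟩
    ½ * ΣQ m (λ k → fromℕ (suc (m ℕ.+ m) C k) * (fromℕ (suc (m ℕ.+ m)) - fromℕ 2 * fromℕ k))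
      ≡⟨ cong (½ *_) (binomial-telescope (m ℕ.+ m) m (ℕP.m≤m+n m m)) ⟩
    ½ * (fromℕ (suc (m ℕ.+ m)) * fromℕ ((m ℕ.+ m) C m)) ∎
    where
    regroup : ∀ c h d → c * (h * d) ≡ h * (c * d)
    regroup = solve-∀ ℚ-ring

foldedRatio-degree≤ : ∀ t → Degree≤ (suc t) (foldedRatio (suc (t ℕ.+ t)))
foldedRatio-degree≤ zero = degree≤-cong 1 (λ m → trans (ℚP.*-identityʳ (½ * fromℕ m + ½)) (sym (foldedRatio-1 m)))
                                        (degree≤-*-linear 0 ½ ½ (degree≤-const 0 1ℚ))
foldedRatio-degree≤ (suc t) = subst (λ s → Degree≤ (suc (suc t)) (foldedRatio s)) (cong (suc ∘ suc) (sym (ℕP.+-suc t t)))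
  (degree≤-cong (suc (suc t)) recurrence
    (degree≤-+ (suc (suc t)) {λ m → ½ * ½ * Q m} {λ m → (1ℚ * fromℕ m + 1ℚ) * g m}
      (degree≤-*ˡ (suc (suc t)) (½ * ½) {Q} (degree≤-suc (suc t) {Q} (foldedRatio-degree≤ t)))
      (degree≤-*-linear (suc t) 1ℚ 1ℚ (degree≤-*-pred t {Δ Q} (foldedRatio-degree≤ t)))))
  where
  s = suc (t ℕ.+ t)
  Q = foldedRatio s
  g : ℕ → ℚ
  g m = fromℕ m * Δ Q (m ℕ.∸ 1)
  recurrence : ∀ m → ½ * ½ * Q m + (1ℚ * fromℕ m + 1ℚ) * g m ≡ foldedRatio (suc (suc s)) m
  recurrence m = sym (trans (foldedRatio-step s m) (cong (λ x → ½ * ½ * Q m + (x + 1ℚ) * g m) (sym (ℚP.*-identityˡ (fromℕ m)))))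

U-odd≡C*foldedRatio : ∀ s m → U s (suc (m ℕ.+ m)) ≡ fromℕ ((2 ℕ.* suc m) C suc m) * foldedRatio s m
U-odd≡C*foldedRatio s m = begin
  U s (suc (m ℕ.+ m))
    ≡⟨ U-odd s m ⟩
  fromℕ 2 * foldedSum s m
    ≡⟨ cong (fromℕ 2 *_) (foldedSum≡foldedRatio*C s m) ⟩
  fromℕ 2 * (foldedRatio s m * fromℕ Cₘ)
    ≡⟨ double (fromℕ Cₘ) (foldedRatio s m) ⟩
  (fromℕ Cₘ + fromℕ Cₘ) * foldedRatio s m
    ≡⟨ cong (_* foldedRatio s m) (trans (cong fromℕ (central-C-double m)) (fromℕ-homo-+ Cₘ Cₘ)) ⟨
  fromℕ ((2 ℕ.* suc m) C suc m) * foldedRatio s m ∎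
  where
  open ≡-Reasoning
  Cₘ = suc (m ℕ.+ m) C m
  double : ∀ c q → fromℕ 2 * (q * c) ≡ (c + c) * q
  double = solve-∀ ℚ-ring

-- The right-hand side

rhsCoefficient : ℕ → ℕ → ℕ → ℚ
rhsCoefficient n r k = fromℤ (rising (ℤ.1ℤ ℤ.- + n) k ℤ.* rising (+ n ℤ.- ℤ.1ℤ ℤ.- + r) (r ℕ.∸ k))
                       * invℕ ((r ℕ.∸ k) !) * invℕ (k !)

rhs-inner : ∀ n r k → ΣQ k (rhsTerm n r k) ≡ rhsCoefficient n r k * foldedRatio (2 ℕ.* r ℕ.∸ 1) k
rhs-inner n r k = begin
  ΣQ k (rhsTerm n r k)
    ≡⟨ ΣQ-cong k term ⟩
  ΣQ k (λ j → c * (fromℕ (N C (k ℕ.∸ j)) * x j))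
    ≡⟨ ΣQ-*ˡ k c (λ j → fromℕ (N C (k ℕ.∸ j)) * x j) ⟩
  c * foldedSum s k
    ≡⟨ cong (λ y → A * i * y * foldedSum s k) (invℕ-homo-* (k !) Cₖ (!≢0 k) (central-C≢0 k)) ⟩
  A * i * (invℕ (k !) * invℕ Cₖ) * foldedSum s k
    ≡⟨ regroup A i (invℕ (k !)) (invℕ Cₖ) (foldedSum s k) ⟩
  rhsCoefficient n r k * foldedRatio s k ∎
  where
  open ≡-Reasoning
  s = 2 ℕ.* r ℕ.∸ 1
  N = suc (k ℕ.+ k)
  Cₖ = N C k
  A = fromℤ (rising (ℤ.1ℤ ℤ.- + n) k ℤ.* rising (+ n ℤ.- ℤ.1ℤ ℤ.- + r) (r ℕ.∸ k))
  i = invℕ ((r ℕ.∸ k) !)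
  c = A * i * invℕ (k ! ℕ.* Cₖ)
  x : ℕ → ℚ
  x j = odd/2 j ^Q s
  regroup : ∀ a i y z w → a * i * (y * z) * w ≡ a * i * y * (w * z)
  regroup = solve-∀ ℚ-ring
  regroup′ : ∀ a i b d x → a * (i * (b * d)) * x ≡ a * i * d * (b * x)
  regroup′ = solve-∀ ℚ-ring
  term : ∀ j → j ℕ.≤ k → rhsTerm n r k j ≡ c * (fromℕ (N C (k ℕ.∸ j)) * x j)
  term j j≤k = begin
    A * invℕ ((r ℕ.∸ k) ! ℕ.* (k ℕ.∸ j) ! ℕ.* ρ) * x j
      ≡⟨ cong (λ y → A * invℕ y * x j) (ℕP.*-assoc ((r ℕ.∸ k) !) ((k ℕ.∸ j) !) ρ) ⟩
    A * invℕ ((r ℕ.∸ k) ! ℕ.* ((k ℕ.∸ j) ! ℕ.* ρ)) * x j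
      ≡⟨ cong (λ y → A * y * x j) (invℕ-homo-* ((r ℕ.∸ k) !) _ (!≢0 (r ℕ.∸ k)) [k∸j]!*ρ≢0) ⟩
    A * (i * invℕ ((k ℕ.∸ j) ! ℕ.* ρ)) * x j
      ≡⟨ cong (λ y → A * (i * y) * x j) (invℕ-unique ((k ℕ.∸ j) ! ℕ.* ρ) _ _ identity (k!*central-C≢0 k)) ⟩
    A * (i * (fromℕ (N C (k ℕ.∸ j)) * invℕ (k ! ℕ.* Cₖ))) * x j
      ≡⟨ regroup′ A i (fromℕ (N C (k ℕ.∸ j))) (invℕ (k ! ℕ.* Cₖ)) (x j) ⟩
    c * (fromℕ (N C (k ℕ.∸ j)) * x j) ∎
    where
    ρ = risingℕ (k ℕ.+ 2) j
    identity = rising-C-identity k j j≤k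
    [k∸j]!*ρ≢0 : (k ℕ.∸ j) ! ℕ.* ρ ≢ 0
    [k∸j]!*ρ≢0 eq = k!*central-C≢0 k (trans (sym identity) (cong (ℕ._* (N C (k ℕ.∸ j))) eq))

rhsCoefficient≡lagrange : ∀ r m k → (- 1ℚ) ^Q r * rhsCoefficient (suc m) r k ≡ lagrange r k m
rhsCoefficient≡lagrange r m k = begin
  s * (fromℤ (rising a k ℤ.* rising b (r ℕ.∸ k)) * i * i′)
    ≡⟨ cong (λ x → s * (x * i * i′)) (trans (fromℤ-homo-* (rising a k) (rising b (r ℕ.∸ k)))
                                            (cong₂ _*_ (fromℤ-rising a k) (fromℤ-rising b (r ℕ.∸ k)))) ⟩
  s * (risingℚ (fromℤ a) k * risingℚ (fromℤ b) (r ℕ.∸ k) * i * i′)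
    ≡⟨ cong₂ (λ x y → s * (risingℚ x k * risingℚ y (r ℕ.∸ k) * i * i′)) a≡ b≡ ⟩
  s * (risingℚ (- fromℕ m) k * risingℚ (fromℕ m - fromℕ r) (r ℕ.∸ k) * i * i′)
    ≡⟨ regroup s (risingℚ (- fromℕ m) k) (risingℚ (fromℕ m - fromℕ r) (r ℕ.∸ k)) i i′ ⟩
  lagrange r k m ∎
  where
  open ≡-Reasoning
  s = (- 1ℚ) ^Q r
  i = invℕ ((r ℕ.∸ k) !)
  i′ = invℕ (k !)
  a = ℤ.1ℤ ℤ.- + suc m
  b = + suc m ℤ.- ℤ.1ℤ ℤ.- + r
  regroup : ∀ s x y i j → s * (x * y * i * j) ≡ s * (x * y) * i * j
  regroup = solve-∀ ℚ-ring
  simplifyᵃ : ∀ m → 1ℚ - (m + 1ℚ) ≡ - m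
  simplifyᵃ = solve-∀ ℚ-ring
  simplifyᵇ : ∀ m r → m + 1ℚ - 1ℚ - r ≡ m - r
  simplifyᵇ = solve-∀ ℚ-ring
  a≡ : fromℤ a ≡ - fromℕ m
  a≡ = trans (fromℤ-homo-- ℤ.1ℤ (+ suc m)) (trans (cong (λ x → 1ℚ - x) (fromℕ-suc m)) (simplifyᵃ (fromℕ m)))
  b≡ : fromℤ b ≡ fromℕ m - fromℕ r
  b≡ = trans (fromℤ-homo-- (+ suc m ℤ.- ℤ.1ℤ) (+ r))
             (trans (cong (_- fromℕ r) (trans (fromℤ-homo-- (+ suc m) ℤ.1ℤ) (cong (_- 1ℚ) (fromℕ-suc m))))
                    (simplifyᵇ (fromℕ m) (fromℕ r)))

rhs-sum : ∀ r m → Degree≤ r (foldedRatio (2 ℕ.* r ℕ.∸ 1)) →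
  ΣQ r (λ k → ΣQ k (rhsTerm (suc m) r k)) ≡ (- 1ℚ) ^Q r * foldedRatio (2 ℕ.* r ℕ.∸ 1) m
rhs-sum r m degree = begin
  ΣQ r (λ k → ΣQ k (rhsTerm (suc m) r k))
    ≡⟨ ΣQ-cong r (λ k _ → rhs-inner (suc m) r k) ⟩
  ΣQ r (λ k → c k * Q k)
    ≡⟨ ΣQ-cong r (λ k _ → sign-absorb r (c k * Q k)) ⟩
  ΣQ r (λ k → s * (s * (c k * Q k)))
    ≡⟨ ΣQ-*ˡ r s (λ k → s * (c k * Q k)) ⟩
  s * ΣQ r (λ k → s * (c k * Q k))
    ≡⟨ cong (s *_) (ΣQ-cong r (λ k _ → to-lagrange k)) ⟩
  s * ΣQ r (λ k → lagrange r k m * Q k)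
    ≡⟨ cong (s *_) (lagrange-interpolation r Q degree m) ⟨
  s * Q m ∎
  where
  open ≡-Reasoning
  s = (- 1ℚ) ^Q r
  Q = foldedRatio (2 ℕ.* r ℕ.∸ 1)
  c = rhsCoefficient (suc m) r
  to-lagrange : ∀ k → s * (c k * Q k) ≡ lagrange r k m * Q k
  to-lagrange k = trans (sym (ℚP.*-assoc s (c k) (Q k))) (cong (_* Q k) (rhsCoefficient≡lagrange r m k))

mainTheorem11 : (r n : ℕ) → 1 ℕ.≤ r → 1 ℕ.≤ n →
    U (2 ℕ.* r ℕ.∸ 1) (2 ℕ.* n ℕ.∸ 1) ≡ RHS r n
mainTheorem11 (suc t) (suc m) _ _ = begin
  U s (2 ℕ.* suc m ℕ.∸ 1)       ≡⟨ cong (U s) (odd-index m) ⟩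
  U s (suc (m ℕ.+ m))           ≡⟨ U-odd≡C*foldedRatio s m ⟩
  fromℕ C₂ₙ * Q m               ≡⟨ sign-absorb r (fromℕ C₂ₙ * Q m) ⟩
  σ * (σ * (fromℕ C₂ₙ * Q m))   ≡⟨ regroup σ (fromℕ C₂ₙ) (Q m) ⟩
  σ * fromℕ C₂ₙ * (σ * Q m)     ≡⟨ cong (σ * fromℕ C₂ₙ *_) (rhs-sum r m degree) ⟨
  RHS r (suc m)                 ∎
  where
  open ≡-Reasoning
  r = suc t
  s = 2 ℕ.* r ℕ.∸ 1
  σ = (- 1ℚ) ^Q r
  Q = foldedRatio s
  C₂ₙ = (2 ℕ.* suc m) C suc m
  regroup : ∀ σ c q → σ * (σ * (c * q)) ≡ σ * c * (σ * q)
  regroup = solve-∀ ℚ-ring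
  degree : Degree≤ r Q
  degree = subst (λ x → Degree≤ r (foldedRatio x)) (sym (odd-index t)) (foldedRatio-degree≤ t)
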